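{- Let $\phi$ be a MAX-2-SAT instance on $n$ variables, let $A$, $d_i$, $f$ and $F$ be as defined in the context, let $0<\epsilon\le1$ and let $\tilde y\in\{ -1,1\}^{2n+1}$. Then for every $y\in[-1,1]^{2n+1}$, $f(y)\le F(y,\tilde y)$.
   Context: MAX-2-SAT instance $\phi$: a CNF formula with $m$ clauses, each of two literals, over variables $x_1,\dots,x_n$; introduce literals $x_{n+i}=\bar x_i$, $i\in[n]$. Let $A\in\mathbb{R}^{(2n+1)\times(2n+1)}$ (indices $0,\dots,2n$) be symmetric with $A_{ij}=A_{ji}=1$ if $(x_i\lor x_j)$ is a clause of $\phi$ and $0$ otherwise (row and column $0$ are zero). Let $d_i$ be the number of clauses containing literal $x_i$, $i\in[2n]$. Define $f(y)=2\sum_{i\in[2n]}y_0y_id_i+\langle y,Ay\rangle$ and $F(y,\tilde y)=2\sum_{i\in[2n]}y_0y_id_i+\langle y,A\tilde y/\epsilon\rangle+\|A(y-\tilde y/\epsilon)\|_1$. -}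

module Defs where

open import Level using (0ℓ)
open import Data.Nat using (ℕ; zero; suc) renaming (_*_ to _*ℕ_)
open import Data.Fin using (Fin; zero; suc)
open import Data.Fin.Properties using () renaming (_≟_ to _≟F_)
open import Data.Bool using (Bool; true; false; if_then_else_; _∧_; _∨_)
open import Data.List using (List; []; _∷_; length)
open import Data.Product using (_×_; _,_; ∃)
open import Relation.Nullary using (¬_; Dec; yes; no)
open import Relation.Nullary.Decidable using (⌊_⌋)
open import Relation.Binary using (Decidable)
open import Relation.Binary.PropositionalEquality using (_≡_)
open import Algebra.Structures using (IsCommutativeRing)
open import Relation.Binary.Structures using (IsTotalOrder)

record RealField : Set₁ where
  infixl 6 _+_
  infixl 7 _*_
  infix 4 _≤_ _<_
  infixl 6 _-_
  infixl 7 _/_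
  infix 8 -_
  field
    R    : Set
    0# 1# : R
    _+_ _*_ : R → R → R
    -_   : R → R
    _⁻¹  : R → R
    _≤_  : R → R → Set
    isCommutativeRing : IsCommutativeRing _≡_ _+_ _*_ -_ 0# 1#
    0≢1 : ¬ (0# ≡ 1#)
    ⁻¹-inverse : ∀ x → ¬ (x ≡ 0#) → x * (x ⁻¹) ≡ 1#
    isTotalOrder : IsTotalOrder _≡_ _≤_
    _≤?_ : Decidable _≤_
    +-mono-≤ : ∀ {x y} z → x ≤ y → x + z ≤ y + z
    *-nonneg : ∀ {x y} → 0# ≤ x → 0# ≤ y → 0# ≤ x * y
    completeness : (P : R → Set) → ∃ P → ∃ (λ b → ∀ x → P x → x ≤ b) →
      ∃ (λ s → (∀ x → P x → x ≤ s) × (∀ b → (∀ x → P x → x ≤ b) → s ≤ b))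

  _<_ : R → R → Set
  x < y = (x ≤ y) × ¬ (x ≡ y)

  _-_ : R → R → R
  x - y = x + (- y)

  _/_ : R → R → R
  x / y = x * (y ⁻¹)

  ∣_∣ : R → R
  ∣ x ∣ with 0# ≤? x
  ... | yes _ = x
  ... | no  _ = - x

  fromℕ : ℕ → R
  fromℕ zero    = 0#
  fromℕ (suc k) = 1# + fromℕ k

  2# : R
  2# = 1# + 1#

  Σ : ∀ {k} → (Fin k → R) → R
  Σ {zero}  g = 0#
  Σ {suc k} g = g zero + Σ (λ i → g (suc i))

  ⟨_,_⟩ : ∀ {k} → (Fin k → R) → (Fin k → R) → R
  ⟨ u , v ⟩ = Σ (λ i → u i * v i)

  _·_ : ∀ {k} → (Fin k → Fin k → R) → (Fin k → R) → (Fin k → R)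
  (M · v) i = Σ (λ j → M i j * v j)

  ‖_‖₁ : ∀ {k} → (Fin k → R) → R
  ‖ v ‖₁ = Σ (λ i → ∣ v i ∣)

-- MAX-2-SAT instances on n variables.
-- Literals x_1..x_{2n} (x_{n+i} = ¬x_i) are indexed by Fin (2n): the
-- literal a : Fin (2n) is x_{toℕ a + 1}, i.e. index (suc a) in 0..2n.

Lit : ℕ → Set
Lit n = Fin (2 *ℕ n)

record Clause (n : ℕ) : Set where
  constructor _∨ₗ_
  field
    fst snd : Lit n

record Formula (n : ℕ) : Set where
  constructor formula
  field
    clauses : List (Clause n)

Idx : ℕ → Set
Idx n = Fin (suc (2 *ℕ n))

clauseIs : ∀ {n} → Clause n → Lit n → Lit n → Bool
clauseIs (a ∨ₗ b) i j =
  (⌊ a ≟F i ⌋ ∧ ⌊ b ≟F j ⌋) ∨ (⌊ a ≟F j ⌋ ∧ ⌊ b ≟F i ⌋)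

isClauseL : ∀ {n} → List (Clause n) → Lit n → Lit n → Bool
isClauseL []       i j = false
isClauseL (c ∷ cs) i j = clauseIs c i j ∨ isClauseL cs i j

isClause : ∀ {n} → Formula n → Lit n → Lit n → Bool
isClause (formula cs) = isClauseL cs

containsLit : ∀ {n} → Clause n → Lit n → Bool
containsLit (a ∨ₗ b) i = ⌊ a ≟F i ⌋ ∨ ⌊ b ≟F i ⌋

degreeL : ∀ {n} → List (Clause n) → Lit n → ℕ
degreeL []       i = zero
degreeL (c ∷ cs) i = if containsLit c i then suc (degreeL cs i) else degreeL cs i

degree : ∀ {n} → Formula n → Lit n → ℕ
degree (formula cs) = degreeL cs

module _ (ℝ : RealField) where
  open RealField ℝ

  adjMatrix : ∀ {n} → Formula n → Idx n → Idx n → R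
  adjMatrix ϕ zero    _       = 0#
  adjMatrix ϕ (suc i) zero    = 0#
  adjMatrix ϕ (suc i) (suc j) = if isClause ϕ i j then 1# else 0#

  fObj : ∀ {n} → Formula n → (Idx n → R) → R
  fObj ϕ y =
    2# * Σ (λ i → y zero * y (suc i) * fromℕ (degree ϕ i))
      + ⟨ y , adjMatrix ϕ · y ⟩

  FObj : ∀ {n} → Formula n → R → (Idx n → R) → (Idx n → R) → R
  FObj ϕ ε y ỹ =
    2# * Σ (λ i → y zero * y (suc i) * fromℕ (degree ϕ i))
      + ⟨ y , (λ k → (adjMatrix ϕ · ỹ) k / ε) ⟩
      + ‖ adjMatrix ϕ · (λ k → y k - ỹ k / ε) ‖₁

-- Write A y = A ỹ/ε + A (y − ỹ/ε). The first part contributes ⟨y, A ỹ/ε⟩ to ⟨y, A y⟩, and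
-- since every |y_i| ≤ 1 the second contributes at most ‖A (y − ỹ/ε)‖₁. The argument works for
-- any matrix, any ε and any ỹ.
module Submission where

open import Defs
open import Data.Nat using (ℕ; zero; suc)
open import Data.Fin using (Fin; zero; suc)
open import Data.Sum using (_⊎_; inj₁; inj₂)
open import Data.Product using (_×_; _,_)
open import Relation.Binary.PropositionalEquality
open import Relation.Nullary using (yes; no)
open import Data.Empty using (⊥-elim)
open import Algebra.Bundles using (CommutativeRing)
import Algebra.Properties.Ring as RingProperties
import Algebra.Properties.Group as GroupProperties
import Algebra.Properties.CommutativeSemigroup as CommutativeSemigroupProperties
open import Relation.Binary.Structures using (IsTotalOrder)

module OrderedFieldLemmas (ℝ : RealField) where
  open RealField ℝ
  open ≡-Reasoning

  commutativeRing : CommutativeRing _ _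
  commutativeRing = record { isCommutativeRing = isCommutativeRing }

  open CommutativeRing commutativeRing
    using (+-comm; distribʳ; zeroˡ; +-identityˡ; *-identityˡ;
           -‿inverseʳ; ring; +-group; +-commutativeSemigroup)
  open RingProperties ring using (-‿distribʳ-*; -‿distribˡ-*)
  open GroupProperties +-group using (//-rightDividesˡ; ⁻¹-involutive; ε⁻¹≈ε)
  open CommutativeSemigroupProperties +-commutativeSemigroup using (interchange)
  open IsTotalOrder isTotalOrder using (total) renaming (trans to ≤-trans; reflexive to ≤-reflexive)

  Σ-cong : ∀ {k} {f g : Fin k → R} → (∀ i → f i ≡ g i) → Σ f ≡ Σ g
  Σ-cong {zero}  f≗g = refl
  Σ-cong {suc k} f≗g = cong₂ _+_ (f≗g zero) (Σ-cong (λ i → f≗g (suc i)))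

  Σ-+ : ∀ {k} (f g : Fin k → R) → Σ (λ i → f i + g i) ≡ Σ f + Σ g
  Σ-+ {zero}  f g = sym (+-identityˡ 0#)
  Σ-+ {suc k} f g =
    trans (cong (f zero + g zero +_) (Σ-+ (λ i → f (suc i)) (λ i → g (suc i))))
          (interchange _ _ _ _)

  Σ-*ʳ : ∀ {k} (f : Fin k → R) c → Σ (λ i → f i * c) ≡ Σ f * c
  Σ-*ʳ {zero}  f c = sym (zeroˡ c)
  Σ-*ʳ {suc k} f c =
    trans (cong (f zero * c +_) (Σ-*ʳ (λ i → f (suc i)) c))
          (sym (distribʳ c (f zero) (Σ (λ i → f (suc i)))))

  +-monoʳ-≤ : ∀ {x y} z → x ≤ y → z + x ≤ z + y
  +-monoʳ-≤ {x} {y} z x≤y = subst₂ _≤_ (+-comm x z) (+-comm y z) (+-mono-≤ z x≤y)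

  Σ-mono-≤ : ∀ {k} {f g : Fin k → R} → (∀ i → f i ≤ g i) → Σ f ≤ Σ g
  Σ-mono-≤ {zero}  f≤g = ≤-reflexive refl
  Σ-mono-≤ {suc k} f≤g =
    ≤-trans (+-mono-≤ _ (f≤g zero)) (+-monoʳ-≤ _ (Σ-mono-≤ (λ i → f≤g (suc i))))

  x≤y⇒0≤y-x : ∀ {x y} → x ≤ y → 0# ≤ y - x
  x≤y⇒0≤y-x {x} {y} x≤y = subst (_≤ y - x) (-‿inverseʳ x) (+-mono-≤ (- x) x≤y)

  0≤y-x⇒x≤y : ∀ {x y} → 0# ≤ y - x → x ≤ y
  0≤y-x⇒x≤y {x} {y} 0≤y-x = subst₂ _≤_ (+-identityˡ x) (//-rightDividesˡ x y) (+-mono-≤ x 0≤y-x)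

  neg-antitone : ∀ {x y} → x ≤ y → - y ≤ - x
  neg-antitone {x} {y} x≤y = 0≤y-x⇒x≤y (subst (0# ≤_) y-x≡-x--y (x≤y⇒0≤y-x x≤y))
    where
    y-x≡-x--y : y - x ≡ - x - - y
    y-x≡-x--y = trans (+-comm y (- x)) (cong (- x +_) (sym (⁻¹-involutive y)))

  neg-*-neg : ∀ x y → - x * - y ≡ x * y
  neg-*-neg x y = begin
    - x * - y       ≡⟨ sym (-‿distribˡ-* x (- y)) ⟩
    - (x * - y)     ≡⟨ cong -_ (sym (-‿distribʳ-* x y)) ⟩
    - (- (x * y))   ≡⟨ ⁻¹-involutive (x * y) ⟩
    x * y           ∎

  *-≤-when-≤1 : ∀ {a w} → a ≤ 1# → 0# ≤ w → a * w ≤ w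
  *-≤-when-≤1 {a} {w} a≤1 0≤w = 0≤y-x⇒x≤y (subst (0# ≤_) [1-a]w≡w-aw (*-nonneg (x≤y⇒0≤y-x a≤1) 0≤w))
    where
    [1-a]w≡w-aw : (1# - a) * w ≡ w - a * w
    [1-a]w≡w-aw = trans (distribʳ w 1# (- a)) (cong₂ _+_ (*-identityˡ w) (sym (-‿distribˡ-* a w)))

  *-≤-∣∣ : ∀ {y} z → - 1# ≤ y → y ≤ 1# → y * z ≤ ∣ z ∣
  *-≤-∣∣ {y} z -1≤y y≤1 with 0# ≤? z
  ... | yes 0≤z = *-≤-when-≤1 y≤1 0≤z
  ... | no  0≰z = subst (_≤ - z) (neg-*-neg y z) (*-≤-when-≤1 -y≤1 0≤-z)
    where
    -y≤1 : - y ≤ 1#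
    -y≤1 = subst (- y ≤_) (⁻¹-involutive 1#) (neg-antitone -1≤y)
    z≤0 : z ≤ 0#
    z≤0 with total z 0#
    ... | inj₁ z≤0 = z≤0
    ... | inj₂ 0≤z = ⊥-elim (0≰z 0≤z)
    0≤-z : 0# ≤ - z
    0≤-z = subst (_≤ - z) ε⁻¹≈ε (neg-antitone z≤0)

module QuadraticForms (ℝ : RealField) where
  open RealField ℝ
  open OrderedFieldLemmas ℝ
  open CommutativeRing commutativeRing using (+-comm; *-assoc; distribˡ)
  open GroupProperties (CommutativeRing.+-group commutativeRing) using (//-rightDividesˡ)

  ·-+ : ∀ {k} (M : Fin k → Fin k → R) (u v : Fin k → R) i →
        (M · (λ j → u j + v j)) i ≡ (M · u) i + (M · v) i
  ·-+ M u v i = trans (Σ-cong (λ j → distribˡ (M i j) (u j) (v j)))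
                    (Σ-+ (λ j → M i j * u j) (λ j → M i j * v j))

  ·-*ʳ : ∀ {k} (M : Fin k → Fin k → R) (u : Fin k → R) c i →
         (M · (λ j → u j * c)) i ≡ (M · u) i * c
  ·-*ʳ M u c i = trans (Σ-cong (λ j → sym (*-assoc (M i j) (u j) c))) (Σ-*ʳ (λ j → M i j * u j) c)

  ⟨⟩-+ʳ : ∀ {k} (y u v : Fin k → R) → ⟨ y , (λ i → u i + v i) ⟩ ≡ ⟨ y , u ⟩ + ⟨ y , v ⟩
  ⟨⟩-+ʳ y u v = trans (Σ-cong (λ i → distribˡ (y i) (u i) (v i)))
                      (Σ-+ (λ i → y i * u i) (λ i → y i * v i))

  ⟨⟩≤‖‖₁ : ∀ {k} (y z : Fin k → R) → (∀ i → (- 1# ≤ y i) × (y i ≤ 1#)) → ⟨ y , z ⟩ ≤ ‖ z ‖₁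
  ⟨⟩≤‖‖₁ y z y∈[-1,1] = Σ-mono-≤ (λ i → let (lo , hi) = y∈[-1,1] i in *-≤-∣∣ (z i) lo hi)

  quadraticForm-split : ∀ {k} (M : Fin k → Fin k → R) (e : R) (y t : Fin k → R) →
    ⟨ y , M · y ⟩ ≡ ⟨ y , (λ i → (M · t) i / e) ⟩ + ⟨ y , M · (λ i → y i - t i / e) ⟩
  quadraticForm-split M e y t = begin
    ⟨ y , M · y ⟩
      ≡⟨ Σ-cong (λ i → cong (y i *_) (Σ-cong (λ j → cong (M i j *_) (y≡t/e+[y-t/e] j)))) ⟩
    ⟨ y , M · (λ j → t j / e + (y j - t j / e)) ⟩
      ≡⟨ Σ-cong (λ i → cong (y i *_) (·-+ M _ _ i)) ⟩
    ⟨ y , (λ i → (M · (λ j → t j / e)) i + (M · (λ j → y j - t j / e)) i) ⟩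
      ≡⟨ ⟨⟩-+ʳ y _ _ ⟩
    ⟨ y , M · (λ j → t j / e) ⟩ + ⟨ y , M · (λ j → y j - t j / e) ⟩
      ≡⟨ cong (_+ ⟨ y , M · (λ j → y j - t j / e) ⟩)
              (Σ-cong (λ i → cong (y i *_) (·-*ʳ M t (e ⁻¹) i))) ⟩
    ⟨ y , (λ i → (M · t) i / e) ⟩ + ⟨ y , M · (λ i → y i - t i / e) ⟩ ∎
    where
    open ≡-Reasoning
    y≡t/e+[y-t/e] : ∀ j → y j ≡ t j / e + (y j - t j / e)
    y≡t/e+[y-t/e] j = trans (sym (//-rightDividesˡ (t j / e) (y j))) (+-comm _ _)

  quadraticForm-bound : ∀ {k} (M : Fin k → Fin k → R) (e : R) (y t : Fin k → R) →
    (∀ i → (- 1# ≤ y i) × (y i ≤ 1#)) →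
    ⟨ y , M · y ⟩ ≤ ⟨ y , (λ i → (M · t) i / e) ⟩ + ‖ M · (λ i → y i - t i / e) ‖₁
  quadraticForm-bound M e y t y∈[-1,1] =
    subst (_≤ ⟨ y , w ⟩ + ‖ z ‖₁) (sym (quadraticForm-split M e y t))
          (+-monoʳ-≤ ⟨ y , w ⟩ (⟨⟩≤‖‖₁ y z y∈[-1,1]))
    where
    w z : Fin _ → R
    w i = (M · t) i / e
    z = M · (λ i → y i - t i / e)

mainTheorem9 : (ℝ : RealField) → let open RealField ℝ in
    (n : ℕ) (ϕ : Formula n) (ε : R) → 0# < ε → ε ≤ 1# →
    (ỹ : Idx n → R) → (∀ k → ỹ k ≡ 1# ⊎ ỹ k ≡ - 1#) →
    (y : Idx n → R) → (∀ k → (- 1# ≤ y k) × (y k ≤ 1#)) →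
    fObj ℝ ϕ y ≤ FObj ℝ ϕ ε y ỹ
mainTheorem9 ℝ n ϕ ε _ _ ỹ _ y y∈[-1,1] =
  subst (fObj ℝ ϕ y ≤_) (sym (+-assoc linearPart _ _))
        (+-monoʳ-≤ linearPart (quadraticForm-bound (adjMatrix ℝ ϕ) ε y ỹ y∈[-1,1]))
  where
  open RealField ℝ
  open OrderedFieldLemmas ℝ
  open QuadraticForms ℝ
  open CommutativeRing commutativeRing using (+-assoc)
  linearPart : R
  linearPart = 2# * Σ (λ i → y zero * y (suc i) * fromℕ (degree ϕ i))
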